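{- Let $k \geq 3$ be an integer and let $n$ be a nonzero integer. Let $a,b,c,d$ be positive integers with $|n|^{\frac{k}{k-2}}\leq a<b<c<d$ such that the product of any two distinct elements of $\{a,b,c,d\}$ plus $n$ is the $k$-th power of an integer. Then $d>a^{k-1}$. -}

module Defs where

open import Data.Nat using (ℕ)
open import Data.Integer using (ℤ; _+_; _*_; _^_; +_)
open import Data.Product using (∃)
open import Relation.Binary.PropositionalEquality using (_≡_)

IsKthPower : ℕ → ℤ → Set
IsKthPower k m = ∃ λ (z : ℤ) → z ^ k ≡ m

ProdPlusPow : ℕ → ℤ → ℕ → ℕ → Set
ProdPlusPow k n x y = IsKthPower k ((+ x) * (+ y) + n)

{-# OPTIONS --safe #-}
-- Let r(x, y) be the natural k-th root of xy + n. For n > 0 put U = r(a,c) r(b,d) and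
-- V = r(a,d) r(b,c) (swap the roles for n < 0); the identity
-- (ac + n)(bd + n) − (ad + n)(bc + n) = n(b − a)(d − c) gives Uᵏ = Vᵏ + |n|(b − a)(d − c),
-- so by Bernoulli's inequality k Vᵏ⁻¹ ≤ |n|(b − a)(d − c) < |n| b d. Since also
-- Vᵏ ≥ a(c − 1) · b(d − 1), comparing (k Vᵏ⁻¹)ᵏ with (Vᵏ)ᵏ⁻¹ and using |n|ᵏ ≤ aᵏ⁻² and
-- c − 1 ≥ a, b leaves aᵏ⁻¹ < d.
module Submission where

open import Defs
open import Data.Nat using (ℕ; _≤_; _<_; _^_; _∸_)
open import Data.Integer using (ℤ; ∣_∣; +_)
open import Relation.Binary.PropositionalEquality using (_≢_)
open import Data.Product using (_×_)

open import Data.Nat using (zero; suc; _+_; _*_; z≤n; s≤s; >-nonZero)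
open import Data.Nat.Properties
open import Data.Nat.Solver using (module +-*-Solver)
open import Data.Integer as ℤ using (-[1+_])
import Data.Integer.Properties as ℤₚ
open import Data.Product using (∃; _,_)
open import Data.Empty using (⊥-elim)
open import Relation.Nullary using (yes; no)
open import Relation.Binary.PropositionalEquality
  using (_≡_; refl; sym; trans; cong; cong₂; subst; module ≡-Reasoning)

open +-*-Solver

^-distribʳ-* : ∀ m n k → (m * n) ^ k ≡ m ^ k * n ^ k
^-distribʳ-* m n zero = refl
^-distribʳ-* m n (suc k) = begin
  m * n * (m * n) ^ k     ≡⟨ cong (m * n *_) (^-distribʳ-* m n k) ⟩
  m * n * (m ^ k * n ^ k) ≡⟨ [m*n]*[o*p]≡[m*o]*[n*p] m n (m ^ k) (n ^ k) ⟩
  m ^ suc k * n ^ suc k   ∎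
  where open ≡-Reasoning

[m^n]^o≡[m^o]^n : ∀ m n o → (m ^ n) ^ o ≡ (m ^ o) ^ n
[m^n]^o≡[m^o]^n m n o = trans (^-*-assoc m n o) (trans (cong (m ^_) (*-comm n o)) (sym (^-*-assoc m o n)))

m^k≤n^k⇒m≤n : ∀ {m n} k → 0 < k → m ^ k ≤ n ^ k → m ≤ n
m^k≤n^k⇒m≤n {m} {n} k@(suc _) _ mᵏ≤nᵏ with m ≤? n
... | yes m≤n = m≤n
... | no m≰n = ⊥-elim (<⇒≱ (^-monoˡ-< k (≰⇒> m≰n)) mᵏ≤nᵏ)

m^k<n^k⇒m<n : ∀ {m n} k → m ^ k < n ^ k → m < n
m^k<n^k⇒m<n {m} {n} k mᵏ<nᵏ with m <? n
... | yes m<n = m<n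
... | no m≮n = ⊥-elim (<⇒≱ mᵏ<nᵏ (^-monoˡ-≤ k (≮⇒≥ m≮n)))

bernoulli : ∀ v j → v ^ suc j + suc j * v ^ j ≤ suc v ^ suc j
bernoulli v zero = ≤-reflexive (solve 1 (λ v → v :* con 1 :+ con 1 := (con 1 :+ v) :* con 1) refl v)
bernoulli v (suc j) = begin
  v * (v * w) + suc (suc j) * (v * w)
    ≤⟨ m≤m+n _ (suc j * w) ⟩
  v * (v * w) + suc (suc j) * (v * w) + suc j * w
    ≡⟨ solve 3 (λ v w j → v :* (v :* w) :+ (con 2 :+ j) :* (v :* w) :+ (con 1 :+ j) :* w
                        := (con 1 :+ v) :* (v :* w :+ (con 1 :+ j) :* w)) refl v w j ⟩
  suc v * (v * w + suc j * w)
    ≤⟨ *-monoʳ-≤ (suc v) (bernoulli v j) ⟩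
  suc v * suc v ^ suc j ∎
  where
  open ≤-Reasoning
  w = v ^ j

-- If u ^ k exceeds v ^ k at all, then u ≥ v + 1, and Bernoulli bounds the excess from below.
^-gap : ∀ u v d j → u ^ suc j ≡ v ^ suc j + d → 0 < d → suc j * v ^ j ≤ d
^-gap u v d j uᵏ≡vᵏ+d 0<d = +-cancelˡ-≤ (v ^ suc j) _ _ (begin
  v ^ suc j + suc j * v ^ j ≤⟨ bernoulli v j ⟩
  suc v ^ suc j            ≤⟨ ^-monoˡ-≤ (suc j) v<u ⟩
  u ^ suc j                ≡⟨ uᵏ≡vᵏ+d ⟩
  v ^ suc j + d            ∎)
  where
  open ≤-Reasoning
  v<u : v < u
  v<u = m^k<n^k⇒m<n (suc j) (begin-strict
    v ^ suc j     ≡⟨ +-identityʳ _ ⟨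
    v ^ suc j + 0 <⟨ +-monoʳ-< (v ^ suc j) 0<d ⟩
    v ^ suc j + d ≡⟨ uᵏ≡vᵏ+d ⟨
    u ^ suc j     ∎)

record KthPowerGap (k d l : ℕ) : Set where
  field
    larger smaller : ℕ
    gap            : larger ^ k ≡ smaller ^ k + d
    bound          : l ≤ smaller ^ k

kthPowerGap⇒< : ∀ {j d l x} → KthPowerGap (suc j) d l → 0 < d → d < x →
                suc j ^ suc j * l ^ j < x ^ suc j
kthPowerGap⇒< {j} {d} {l} {x} g 0<d d<x = begin-strict
  k ^ k * l ^ j        ≤⟨ *-monoʳ-≤ (k ^ k) (^-monoˡ-≤ j bound) ⟩
  k ^ k * (v ^ k) ^ j  ≡⟨ cong (k ^ k *_) ([m^n]^o≡[m^o]^n v k j) ⟩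
  k ^ k * (v ^ j) ^ k  ≡⟨ ^-distribʳ-* k (v ^ j) k ⟨
  (k * v ^ j) ^ k      ≤⟨ ^-monoˡ-≤ k (^-gap larger v d j gap 0<d) ⟩
  d ^ k                <⟨ ^-monoˡ-< k d<x ⟩
  x ^ k                ∎
  where
  open ≤-Reasoning
  open KthPowerGap g renaming (smaller to v)
  k = suc j

∣i^k∣≡∣i∣^k : ∀ i k → ∣ i ℤ.^ k ∣ ≡ ∣ i ∣ ^ k
∣i^k∣≡∣i∣^k i zero = refl
∣i^k∣≡∣i∣^k i (suc k) = trans (ℤₚ.∣i*j∣≡∣i∣*∣j∣ i (i ℤ.^ k)) (cong (∣ i ∣ *_) (∣i^k∣≡∣i∣^k i k))

kthPower⇒kthPowerℕ : ∀ k m → IsKthPower k (+ m) → ∃ λ r → r ^ k ≡ m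
kthPower⇒kthPowerℕ k m (z , zᵏ≡m) = ∣ z ∣ , trans (sym (∣i^k∣≡∣i∣^k z k)) (cong ∣_∣ zᵏ≡m)

prodPlusPow⁺ : ∀ k n x y → ProdPlusPow k (+ n) x y → ∃ λ r → r ^ k ≡ x * y + n
prodPlusPow⁺ k n x y h = kthPower⇒kthPowerℕ k (x * y + n)
  (subst (IsKthPower k) (cong (ℤ._+ + n) (sym (ℤₚ.pos-* x y))) h)

prodPlusPow⁻ : ∀ k n x y → suc n ≤ x * y → ProdPlusPow k -[1+ n ] x y →
               ∃ λ r → r ^ k + suc n ≡ x * y
prodPlusPow⁻ k n x y 1+n≤xy h with kthPower⇒kthPowerℕ k (x * y ∸ suc n)
  (subst (IsKthPower k) (trans (cong (ℤ._+ -[1+ n ]) (sym (ℤₚ.pos-* x y))) (ℤₚ.⊖-≥ 1+n≤xy)) h)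
... | r , rᵏ≡xy∸1+n = r , trans (cong (_+ suc n) rᵏ≡xy∸1+n) (m∸n+n≡m 1+n≤xy)

cross-product-gap : ∀ a p c q n →
  (a * c + n) * ((a + p) * (c + q) + n) ≡ (a * (c + q) + n) * ((a + p) * c + n) + n * p * q
cross-product-gap = solve 5 (λ a p c q n →
  (a :* c :+ n) :* ((a :+ p) :* (c :+ q) :+ n)
    := (a :* (c :+ q) :+ n) :* ((a :+ p) :* c :+ n) :+ n :* p :* q) refl

cross-sum-gap : ∀ a p c q → a * c + (a + p) * (c + q) ≡ a * (c + q) + (a + p) * c + p * q
cross-sum-gap = solve 4 (λ a p c q →
  a :* c :+ (a :+ p) :* (c :+ q) := a :* (c :+ q) :+ (a :+ p) :* c :+ p :* q) refl

shifted-product : ∀ x y z w n t → (x + n) * (y + n) ≡ (z + n) * (w + n) →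
  (z + n) + (w + n) ≡ (x + n) + (y + n) + t → x * y ≡ z * w + n * t
shifted-product x y z w n t prod sum = +-cancelʳ-≡ (n * (x + y) + n * n) _ _ (begin
  x * y + (n * (x + y) + n * n)     ≡⟨ solve 3 (λ x y n → x :* y :+ (n :* (x :+ y) :+ n :* n)
                                                        := (x :+ n) :* (y :+ n)) refl x y n ⟩
  (x + n) * (y + n)                 ≡⟨ prod ⟩
  (z + n) * (w + n)                 ≡⟨ solve 3 (λ z w n → (z :+ n) :* (w :+ n)
                                                        := z :* w :+ n :* (z :+ w) :+ n :* n) refl z w n ⟩
  z * w + n * (z + w) + n * n       ≡⟨ cong (λ s → z * w + n * s + n * n) z+w≡x+y+t ⟩
  z * w + n * (x + y + t) + n * n   ≡⟨ solve 6 (λ z w n x y t → z :* w :+ n :* (x :+ y :+ t) :+ n :* n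
                                          := z :* w :+ n :* t :+ (n :* (x :+ y) :+ n :* n)) refl z w n x y t ⟩
  z * w + n * t + (n * (x + y) + n * n) ∎)
  where
  open ≡-Reasoning
  z+w≡x+y+t : z + w ≡ x + y + t
  z+w≡x+y+t = +-cancelʳ-≡ (n + n) _ _ (begin
    z + w + (n + n)           ≡⟨ solve 3 (λ z w n → z :+ w :+ (n :+ n) := (z :+ n) :+ (w :+ n)) refl z w n ⟩
    (z + n) + (w + n)         ≡⟨ sum ⟩
    (x + n) + (y + n) + t     ≡⟨ solve 4 (λ x y n t → (x :+ n) :+ (y :+ n) :+ t := x :+ y :+ t :+ (n :+ n)) refl x y n t ⟩
    x + y + t + (n + n)       ∎)

[m*n]*[o*p]≡[m*p]*[o*n] : ∀ m n o p → m * n * (o * p) ≡ m * p * (o * n)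
[m*n]*[o*p]≡[m*p]*[o*n] = solve 4 (λ m n o p → m :* n :* (o :* p) := m :* p :* (o :* n)) refl

quadrupleGap⁺ : ∀ k n {a b c d p q} → a + p ≡ b → suc c + q ≡ suc d →
  ProdPlusPow k (+ n) a (suc c) → ProdPlusPow k (+ n) a (suc d) →
  ProdPlusPow k (+ n) b (suc c) → ProdPlusPow k (+ n) b (suc d) →
  KthPowerGap k (n * p * q) (a * c * (b * d))
quadrupleGap⁺ k n {a} {_} {c} {_} {p} {q} refl refl hac had hbc hbd
  with prodPlusPow⁺ k n a (suc c) hac       | prodPlusPow⁺ k n a (suc (c + q)) had
     | prodPlusPow⁺ k n (a + p) (suc c) hbc | prodPlusPow⁺ k n (a + p) (suc (c + q)) hbd
... | rac , eac | rad , ead | rbc , ebc | rbd , ebd =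
  record { larger = rac * rbd ; smaller = rad * rbc ; gap = gap ; bound = bound }
  where
  open ≤-Reasoning
  b = a + p
  d = c + q
  smallerᵏ : (rad * rbc) ^ k ≡ (a * suc d + n) * (b * suc c + n)
  smallerᵏ = trans (^-distribʳ-* rad rbc k) (cong₂ _*_ ead ebc)
  gap : (rac * rbd) ^ k ≡ (rad * rbc) ^ k + n * p * q
  gap = begin-equality
    (rac * rbd) ^ k                               ≡⟨ ^-distribʳ-* rac rbd k ⟩
    rac ^ k * rbd ^ k                             ≡⟨ cong₂ _*_ eac ebd ⟩
    (a * suc c + n) * (b * suc d + n)             ≡⟨ cross-product-gap a p (suc c) q n ⟩
    (a * suc d + n) * (b * suc c + n) + n * p * q ≡⟨ cong (_+ n * p * q) smallerᵏ ⟨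
    (rad * rbc) ^ k + n * p * q                   ∎
  x*y≤x*[1+y]+n : ∀ x y → x * y ≤ x * suc y + n
  x*y≤x*[1+y]+n x y = ≤-trans (*-monoʳ-≤ x (n≤1+n y)) (m≤m+n _ n)
  bound : a * c * (b * d) ≤ (rad * rbc) ^ k
  bound = begin
    a * c * (b * d)                   ≡⟨ [m*n]*[o*p]≡[m*p]*[o*n] a c b d ⟩
    a * d * (b * c)                   ≤⟨ *-mono-≤ (x*y≤x*[1+y]+n a d) (x*y≤x*[1+y]+n b c) ⟩
    (a * suc d + n) * (b * suc c + n) ≡⟨ smallerᵏ ⟨
    (rad * rbc) ^ k                   ∎

quadrupleGap⁻ : ∀ k n {a b c d p q} → a + p ≡ b → suc c + q ≡ suc d → suc n ≤ a →
  ProdPlusPow k -[1+ n ] a (suc c) → ProdPlusPow k -[1+ n ] a (suc d) →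
  ProdPlusPow k -[1+ n ] b (suc c) → ProdPlusPow k -[1+ n ] b (suc d) →
  KthPowerGap k (suc n * p * q) (a * c * (b * d))
quadrupleGap⁻ k n {a} {_} {c} {_} {p} {q} refl refl 1+n≤a hac had hbc hbd
  with prodPlusPow⁻ k n a (suc c) (1+n≤x*[1+y] a c ≤-refl) hac
     | prodPlusPow⁻ k n a (suc (c + q)) (1+n≤x*[1+y] a (c + q) ≤-refl) had
     | prodPlusPow⁻ k n (a + p) (suc c) (1+n≤x*[1+y] (a + p) c (m≤m+n a p)) hbc
     | prodPlusPow⁻ k n (a + p) (suc (c + q)) (1+n≤x*[1+y] (a + p) (c + q) (m≤m+n a p)) hbd
  where
  1+n≤x*[1+y] : ∀ x y → a ≤ x → suc n ≤ x * suc y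
  1+n≤x*[1+y] x y a≤x = ≤-trans (≤-trans 1+n≤a a≤x) (m≤m*n x (suc y))
... | rac , eac | rad , ead | rbc , ebc | rbd , ebd =
  record { larger = rad * rbc ; smaller = rac * rbd ; gap = gap ; bound = bound }
  where
  open ≤-Reasoning
  b = a + p
  d = c + q
  prod : (rad ^ k + suc n) * (rbc ^ k + suc n) ≡ (rac ^ k + suc n) * (rbd ^ k + suc n)
  prod = begin-equality
    (rad ^ k + suc n) * (rbc ^ k + suc n) ≡⟨ cong₂ _*_ ead ebc ⟩
    a * suc d * (b * suc c)               ≡⟨ [m*n]*[o*p]≡[m*p]*[o*n] a (suc d) b (suc c) ⟩
    a * suc c * (b * suc d)               ≡⟨ cong₂ _*_ eac ebd ⟨
    (rac ^ k + suc n) * (rbd ^ k + suc n) ∎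
  sum : (rac ^ k + suc n) + (rbd ^ k + suc n) ≡ (rad ^ k + suc n) + (rbc ^ k + suc n) + p * q
  sum = begin-equality
    (rac ^ k + suc n) + (rbd ^ k + suc n)         ≡⟨ cong₂ _+_ eac ebd ⟩
    a * suc c + b * suc d                         ≡⟨ cross-sum-gap a p (suc c) q ⟩
    a * suc d + b * suc c + p * q                 ≡⟨ cong (_+ p * q) (cong₂ _+_ ead ebc) ⟨
    (rad ^ k + suc n) + (rbc ^ k + suc n) + p * q ∎
  gap : (rad * rbc) ^ k ≡ (rac * rbd) ^ k + suc n * p * q
  gap = begin-equality
    (rad * rbc) ^ k                     ≡⟨ ^-distribʳ-* rad rbc k ⟩
    rad ^ k * rbc ^ k                   ≡⟨ shifted-product (rad ^ k) (rbc ^ k) (rac ^ k) (rbd ^ k) (suc n) (p * q) prod sum ⟩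
    rac ^ k * rbd ^ k + suc n * (p * q) ≡⟨ cong₂ _+_ (^-distribʳ-* rac rbd k) (*-assoc (suc n) p q) ⟨
    (rac * rbd) ^ k + suc n * p * q     ∎
  x*y≤root : ∀ {r x y} → a ≤ x → r + suc n ≡ x * suc y → x * y ≤ r
  x*y≤root {r} {x} {y} a≤x r+1+n≡x[1+y] = +-cancelʳ-≤ (suc n) (x * y) r (begin
    x * y + suc n ≤⟨ +-monoʳ-≤ (x * y) (≤-trans 1+n≤a a≤x) ⟩
    x * y + x     ≡⟨ trans (+-comm (x * y) x) (sym (*-suc x y)) ⟩
    x * suc y     ≡⟨ r+1+n≡x[1+y] ⟨
    r + suc n     ∎)
  bound : a * c * (b * d) ≤ (rac * rbd) ^ k
  bound = begin
    a * c * (b * d)   ≤⟨ *-mono-≤ (x*y≤root ≤-refl eac) (x*y≤root (m≤m+n a p) ebd) ⟩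
    rac ^ k * rbd ^ k ≡⟨ ^-distribʳ-* rac rbd k ⟨
    (rac * rbd) ^ k   ∎

-- The four numbers are a, b, c + 1, d + 1; stating the bound with c and d avoids truncated subtraction.
quadrupleGap : ∀ k n {a b c d p q} → a + p ≡ b → suc c + q ≡ suc d → ∣ n ∣ ≤ a →
  ProdPlusPow k n a (suc c) → ProdPlusPow k n a (suc d) →
  ProdPlusPow k n b (suc c) → ProdPlusPow k n b (suc d) →
  KthPowerGap k (∣ n ∣ * p * q) (a * c * (b * d))
quadrupleGap k (+ n)    b≡a+p d≡c+q _     = quadrupleGap⁺ k n b≡a+p d≡c+q
quadrupleGap k -[1+ n ] b≡a+p d≡c+q 1+n≤a = quadrupleGap⁻ k n b≡a+p d≡c+q 1+n≤a

differenceProduct-bounds : ∀ {n a b c d} → 0 < n → a < b → c < d →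
  0 < n * (b ∸ a) * (d ∸ c) × n * (b ∸ a) * (d ∸ c) < n * b * suc d
differenceProduct-bounds {n} {a} {b} {c} {d} 0<n a<b c<d =
  *-mono-< (*-mono-< 0<n (m<n⇒0<n∸m a<b)) (m<n⇒0<n∸m c<d) , (begin-strict
    n * (b ∸ a) * (d ∸ c) ≤⟨ *-monoˡ-≤ (d ∸ c) (*-monoʳ-≤ n (m∸n≤m b a)) ⟩
    n * b * (d ∸ c)       <⟨ *-monoʳ-< (n * b) {{>-nonZero 0<nb}} (s≤s (m∸n≤m d c)) ⟩
    n * b * suc d         ∎)
  where
  open ≤-Reasoning
  0<nb : 0 < n * b
  0<nb = *-mono-< 0<n (≤-trans (s≤s z≤n) a<b)

a^[1+m]<1+d : ∀ m n a b c d → n ^ suc (suc m) ≤ a ^ m → a ≤ c → b ≤ c → 0 < d →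
  suc (suc m) ^ suc (suc m) * (a * c * (b * d)) ^ suc m < (n * b * suc d) ^ suc (suc m) →
  a ^ suc m < suc d
a^[1+m]<1+d m n a b c d nᵏ≤aᵐ a≤c b≤c 0<d kᵏLʲ<Xᵏ =
  *-cancelˡ-< x (a ^ j) (suc d) (≤-<-trans lower (<-≤-trans kᵏLʲ<Xᵏ upper))
  where
  open ≤-Reasoning
  j = suc m
  k = suc j
  -- the common factor left after bounding cʲ ≥ b aᵐ and kᵏ ≥ 2ʲ below, and (d+1)ʲ ≤ 2ʲ dʲ above
  x = a ^ m * b ^ k * 2 ^ j * d ^ j
  lower : x * a ^ j ≤ k ^ k * (a * c * (b * d)) ^ j
  lower = begin
    x * a ^ j
      ≡⟨ solve 6 (λ A M B BJ T DJ → M :* (B :* BJ) :* T :* DJ :* A := T :* (A :* (B :* M) :* (BJ :* DJ)))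
           refl (a ^ j) (a ^ m) b (b ^ j) (2 ^ j) (d ^ j) ⟩
    2 ^ j * (a ^ j * (b * a ^ m) * (b ^ j * d ^ j))
      ≤⟨ *-mono-≤ 2ʲ≤kᵏ (*-monoˡ-≤ (b ^ j * d ^ j) (*-monoʳ-≤ (a ^ j) (*-mono-≤ b≤c (^-monoˡ-≤ m a≤c)))) ⟩
    k ^ k * (a ^ j * c ^ j * (b ^ j * d ^ j))
      ≡⟨ cong (k ^ k *_) (trans (^-distribʳ-* (a * c) (b * d) j)
                                (cong₂ _*_ (^-distribʳ-* a c j) (^-distribʳ-* b d j))) ⟨
    k ^ k * (a * c * (b * d)) ^ j ∎
    where
    2ʲ≤kᵏ : 2 ^ j ≤ k ^ k
    2ʲ≤kᵏ = ≤-trans (^-monoʳ-≤ 2 (n≤1+n j)) (^-monoˡ-≤ k (s≤s (s≤s z≤n)))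
  upper : (n * b * suc d) ^ k ≤ x * suc d
  upper = begin
    (n * b * suc d) ^ k
      ≡⟨ trans (^-distribʳ-* (n * b) (suc d) k) (cong (_* suc d ^ k) (^-distribʳ-* n b k)) ⟩
    n ^ k * b ^ k * (suc d * suc d ^ j)
      ≤⟨ *-mono-≤ (*-monoˡ-≤ (b ^ k) nᵏ≤aᵐ) (*-monoʳ-≤ (suc d) (^-monoˡ-≤ j 1+d≤2d)) ⟩
    a ^ m * b ^ k * (suc d * (2 * d) ^ j)
      ≡⟨ cong (λ t → a ^ m * b ^ k * (suc d * t)) (^-distribʳ-* 2 d j) ⟩
    a ^ m * b ^ k * (suc d * (2 ^ j * d ^ j))
      ≡⟨ solve 5 (λ M B D T DJ → M :* B :* (D :* (T :* DJ)) := M :* B :* T :* DJ :* D)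
           refl (a ^ m) (b ^ k) (suc d) (2 ^ j) (d ^ j) ⟩
    x * suc d ∎
    where
    1+d≤2d : suc d ≤ 2 * d
    1+d≤2d = subst (suc d ≤_) (cong (_+_ d) (sym (+-identityʳ d))) (+-monoˡ-≤ d 0<d)

corollary3p8 : (k : ℕ) → 3 ≤ k → (n : ℤ) → n ≢ + 0 →
    (a b c d : ℕ) → 0 < a →
    ∣ n ∣ ^ k ≤ a ^ (k ∸ 2) →
    a < b → b < c → c < d →
    ProdPlusPow k n a b → ProdPlusPow k n a c → ProdPlusPow k n a d →
    ProdPlusPow k n b c → ProdPlusPow k n b d → ProdPlusPow k n c d →
    a ^ (k ∸ 1) < d
corollary3p8 k@(suc (suc m)) (s≤s (s≤s _)) n n≢0 a b (suc c) (suc d) 0<a ∣n∣ᵏ≤aᵐ a<b (s≤s b≤c) c<d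
             _ hac had hbc hbd _ =
  let 0<D , D<X = differenceProduct-bounds 0<∣n∣ a<b (≤-pred c<d)
      gap = quadrupleGap k n (m+[n∸m]≡n (<⇒≤ a<b)) (m+[n∸m]≡n (<⇒≤ c<d)) ∣n∣≤a hac had hbc hbd
  in a^[1+m]<1+d m ∣ n ∣ a b c d ∣n∣ᵏ≤aᵐ (<⇒≤ (<-≤-trans a<b b≤c)) b≤c (≤-trans (s≤s z≤n) (≤-pred c<d))
       (kthPowerGap⇒< gap 0<D D<X)
  where
  0<∣n∣ : 0 < ∣ n ∣
  0<∣n∣ = n≢0⇒n>0 (λ ∣n∣≡0 → n≢0 (ℤₚ.∣i∣≡0⇒i≡0 ∣n∣≡0))
  ∣n∣≤a : ∣ n ∣ ≤ a
  ∣n∣≤a = m^k≤n^k⇒m≤n k (s≤s z≤n) (≤-trans ∣n∣ᵏ≤aᵐ (^-monoʳ-≤ a {{>-nonZero 0<a}} (m≤n+m m 2)))
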